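{- Given a power series $\mathbf{A}(x)=\sum a(n)x^n$ and a positive integer $m$, let $\mathbf{A}_m(x)=\big(\sum_{j=0}^{m-1}x^j\big)\cdot\mathbf{A}(x)$. Then: (a) if $\mathbf{A}_m(x)\in\mathsf{RTN}_1$, then $a(n)-a(n-m)=o\big(\sum_{j=0}^{m-1}a(n-j)\big)$ as $n\to\infty$; (b) if $\mathbf{A}_{m_i}(x)\in\mathsf{RTN}_1$ for $i=1,\dots,k$ and $d=\gcd(m_1,\dots,m_k)$, then $a(n)-a(n-d)=o\big(\sum_{j=0}^ua(n-j)\big)$ for a suitable choice of $u$; (c) if in (b) $d=1$, then $\mathbf{A}(x)\in\mathsf{RTN}_1$.
   Context: $\mathsf{RTN}_1$ is the set of $\mathbf{R}(x)=\sum r(n)x^n\in\mathbb{N}[[x]]$ (nonnegative integer coefficients) with $r(n)>0$ for all sufficiently large $n$ and $\lim_{n\to\infty}r(n-1)/r(n)=1$. -}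

module Defs where

open import Data.Nat using (ℕ; zero; suc; _+_; _*_; _∸_; _≤_; _<_; _≥_; ∣_-_∣)
open import Data.Nat.GCD using (gcd)
open import Data.List using (List; foldr)
open import Data.Product using (Σ; _×_; ∃-syntax)

Series : Set
Series = ℕ → ℕ

-- coefficient a(n - j), with the convention a(negative index) = 0
back : Series → ℕ → ℕ → ℕ
back a n zero = a n
back a zero (suc j) = 0
back a (suc n) (suc j) = back a n j

windowSum : Series → ℕ → ℕ → ℕ
windowSum a zero n = 0
windowSum a (suc m) n = windowSum a m n + back a n m

-- A_m(x) = (Σ_{j=0}^{m-1} x^j) · A(x): its n-th coefficient is Σ_{j<m} a(n-j)
seriesA : Series → ℕ → Series
seriesA a m n = windowSum a m n

-- RTN₁: r(n) > 0 for all large n, and r(n-1)/r(n) → 1, i.e.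
-- for every ε = 1/(k+1) eventually |r(n-1) - r(n)| ≤ ε·r(n).
RTN₁ : Series → Set
RTN₁ r =
  (∃[ N ] ∀ n → N ≤ n → 0 < r n) ×
  (∀ k → ∃[ N ] ∀ n → N ≤ n → suc k * ∣ r (n ∸ 1) - r n ∣ ≤ r n)

-- f = o(g) as n → ∞ (f an absolute value, g ≥ 0):
-- for every ε = 1/(k+1), eventually |f(n)| ≤ ε·g(n).
LittleO : (ℕ → ℕ) → (ℕ → ℕ) → Set
LittleO f g = ∀ k → ∃[ N ] ∀ n → N ≤ n → suc k * f n ≤ g n

diffAbs : Series → ℕ → ℕ → ℕ
diffAbs a m n = ∣ a n - back a n m ∣

gcdList : List ℕ → ℕ
gcdList = foldr gcd 0

module Submission where

-- (a) The n-th coefficient of A_m is W(n) = Σ_{j<m} a(n-j), and W(n) - W(n-1) = a(n) - a(n-m);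
--     the ratio condition of RTN₁ for W is literally |W(n-1) - W(n)| = o(W(n)).
-- (b) Fix a reference scale R with a ≤ R and R(n-1) ≤ 2R(n) eventually ("doubling").  Call m a
--     period if a(n) - a(n-m) = o(R).  Doubling lets o(R) estimates be shifted back by a fixed
--     lag, so by the triangle inequality periods are closed under sums and differences, hence
--     under gcd via Bézout.  Taking R = A_{m₁} (in RTN₁, so doubling), part (a) together with
--     A_m = O(R) makes each mᵢ a period, so gcd(ms) is one.
-- (c) If 1 is a period at scale W = A_{u+1}, every lag is, so W(n) ≤ (u+1)a(n) + o(W(n)) and
--     W = O(a); positivity and the ratio condition then pass from W to a.

open import Defs
open import Data.Nat using (ℕ; zero; suc; _+_; _*_; _∸_; _^_; _⊔_; _≤_; _<_; z≤n; s≤s; ∣_-_∣)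
open import Data.Nat.Properties
open import Data.Nat.Solver using (module +-*-Solver)
open import Data.Nat.GCD using (gcd; gcd-GCD; module Bézout)
open import Data.List using (List; []; _∷_)
open import Data.List.Relation.Unary.All using (All; []; _∷_) renaming (map to All-map)
open import Data.Empty using (⊥-elim)
open import Data.Product using (_×_; _,_; ∃-syntax)
open import Relation.Binary.PropositionalEquality using (_≡_; _≢_; refl; sym; trans; cong; cong₂; subst; module ≡-Reasoning)

Eventually : (ℕ → Set) → Set
Eventually P = ∃[ N ] (∀ n → N ≤ n → P n)

eventually-map : ∀ {P Q : ℕ → Set} → (∀ {n} → P n → Q n) → Eventually P → Eventually Q
eventually-map f (N , p) = N , λ n N≤n → f (p n N≤n)

eventually-both : ∀ {P Q : ℕ → Set} → Eventually P → Eventually Q → Eventually (λ n → P n × Q n)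
eventually-both (M , p) (N , q) =
  M ⊔ N , λ n le → p n (m⊔n≤o⇒m≤o M N le) , q n (m⊔n≤o⇒n≤o M N le)

o-weakenʳ : ∀ {f g h : ℕ → ℕ} C → LittleO f g → Eventually (λ n → g n ≤ C * h n) → LittleO f h
o-weakenʳ {f} {g} {h} C f≪g g≲h k = eventually-map bound (eventually-both (f≪g (k + C * suc k)) g≲h)
  where
  open ≤-Reasoning
  bound : ∀ {n} → suc C * suc k * f n ≤ g n × g n ≤ C * h n → suc k * f n ≤ h n
  bound {n} (f≤g , g≤h) = *-cancelˡ-≤ (suc C) (begin
    suc C * (suc k * f n) ≡⟨ *-assoc (suc C) (suc k) (f n) ⟨
    suc C * suc k * f n   ≤⟨ f≤g ⟩
    g n                   ≤⟨ g≤h ⟩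
    C * h n               ≤⟨ m≤n+m (C * h n) (h n) ⟩
    suc C * h n           ∎)

o-≤ˡ : ∀ {e f h : ℕ → ℕ} → Eventually (λ n → e n ≤ f n) → LittleO f h → LittleO e h
o-≤ˡ {e} {f} {h} e≤f f≪h k = eventually-map bound (eventually-both e≤f (f≪h k))
  where
  bound : ∀ {n} → e n ≤ f n × suc k * f n ≤ h n → suc k * e n ≤ h n
  bound (e≤f , f≤h) = ≤-trans (*-monoʳ-≤ (suc k) e≤f) f≤h

o-zero : ∀ {h : ℕ → ℕ} → LittleO (λ _ → 0) h
o-zero {h} k = 0 , λ n _ → subst (_≤ h n) (sym (*-zeroʳ (suc k))) z≤n

o-+ : ∀ {f g h : ℕ → ℕ} → LittleO f h → LittleO g h → LittleO (λ n → f n + g n) h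
o-+ {f} {g} {h} f≪h g≪h k = eventually-map bound (eventually-both (f≪h k′) (g≪h k′))
  where
  -- suc k′ = 2·(k+1), i.e. the precision ε/2
  k′ : ℕ
  k′ = k + (suc k + 0)
  open ≤-Reasoning
  open +-*-Solver
  bound : ∀ {n} → 2 * suc k * f n ≤ h n × 2 * suc k * g n ≤ h n → suc k * (f n + g n) ≤ h n
  bound {n} (f≤h , g≤h) = *-cancelˡ-≤ 2 (begin
    2 * (suc k * (f n + g n))            ≡⟨ solve 3 (λ K F G → con 2 :* (K :* (F :+ G))
                                                      := con 2 :* K :* F :+ con 2 :* K :* G)
                                                 refl (suc k) (f n) (g n) ⟩
    2 * suc k * f n + 2 * suc k * g n    ≤⟨ +-mono-≤ f≤h g≤h ⟩
    h n + h n                            ≡⟨ cong (h n +_) (+-identityʳ (h n)) ⟨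
    2 * h n                              ∎)

eventually-delay : ∀ {P : ℕ → Set} s → Eventually P → Eventually (λ n → P (n ∸ s))
eventually-delay s (N , p) =
  N + s , λ n N+s≤n → p (n ∸ s) (subst (_≤ n ∸ s) (m+n∸n≡m N s) (∸-monoˡ-≤ s N+s≤n))

-- |r(n-1) - r(n)|: the ratio condition of RTN₁ r says exactly LittleO (stepDiff r) r.
stepDiff : Series → ℕ → ℕ
stepDiff r n = ∣ r (n ∸ 1) - r n ∣

-- r(n-1) ≤ 2·r(n) eventually.  This is the only consequence of r(n-1)/r(n) → 1 needed
-- to move o(r) estimates back by a fixed lag.
Doubling : Series → Set
Doubling r = Eventually (λ n → r (n ∸ 1) ≤ 2 * r n)

rtn-doubling : ∀ r → RTN₁ r → Doubling r
rtn-doubling r (_ , ratio) = eventually-map bound (ratio 0)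
  where
  open ≤-Reasoning
  bound : ∀ {n} → 1 * stepDiff r n ≤ r n → r (n ∸ 1) ≤ 2 * r n
  bound {n} d≤r = begin
    r (n ∸ 1)          ≤⟨ m≤n+∣m-n∣ (r (n ∸ 1)) (r n) ⟩
    r n + stepDiff r n ≤⟨ +-monoʳ-≤ (r n) (subst (_≤ r n) (*-identityˡ (stepDiff r n)) d≤r) ⟩
    r n + r n          ≡⟨ cong (r n +_) (+-identityʳ (r n)) ⟨
    2 * r n            ∎

doubling-iterate : ∀ {r} → Doubling r → ∀ s → Eventually (λ n → r (n ∸ s) ≤ 2 ^ s * r n)
doubling-iterate {r} _ zero = 0 , λ n _ → ≤-reflexive (sym (*-identityˡ (r n)))
doubling-iterate {r} dbl (suc s) =
  eventually-map bound (eventually-both (eventually-delay 1 (doubling-iterate {r} dbl s)) dbl)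
  where
  open ≤-Reasoning
  bound : ∀ {n} → r (n ∸ 1 ∸ s) ≤ 2 ^ s * r (n ∸ 1) × r (n ∸ 1) ≤ 2 * r n →
          r (n ∸ suc s) ≤ 2 * 2 ^ s * r n
  bound {n} (back-s , back-1) = begin
    r (n ∸ suc s)       ≡⟨ cong r (∸-+-assoc n 1 s) ⟨
    r (n ∸ 1 ∸ s)       ≤⟨ back-s ⟩
    2 ^ s * r (n ∸ 1)   ≤⟨ *-monoʳ-≤ (2 ^ s) back-1 ⟩
    2 ^ s * (2 * r n)   ≡⟨ *-assoc (2 ^ s) 2 (r n) ⟨
    2 ^ s * 2 * r n     ≡⟨ cong (_* r n) (*-comm (2 ^ s) 2) ⟩
    2 * 2 ^ s * r n     ∎

o-shift : ∀ {f h : ℕ → ℕ} → Doubling h → ∀ s → LittleO f h → LittleO (λ n → f (n ∸ s)) h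
o-shift dbl s f≪h = o-weakenʳ (2 ^ s) (λ k → eventually-delay s (f≪h k)) (doubling-iterate dbl s)

back-shift : ∀ (a : Series) i n j → i ≤ n → back a (n ∸ i) j ≡ back a n (i + j)
back-shift a zero    n       j _         = refl
back-shift a (suc i) (suc n) j (s≤s i≤n) = back-shift a i n j i≤n

∣-∣-balance : ∀ x b c y → x + b ≡ c + y → ∣ c - b ∣ ≡ ∣ x - y ∣
∣-∣-balance x b c y x+b≡c+y = begin
  ∣ c - b ∣         ≡⟨ ∣m+n-m+o∣≡∣n-o∣ y c b ⟨
  ∣ y + c - y + b ∣ ≡⟨ cong₂ ∣_-_∣ (+-comm y c) (+-comm y b) ⟩
  ∣ c + y - b + y ∣ ≡⟨ cong₂ ∣_-_∣ (trans (sym x+b≡c+y) (+-comm x b)) refl ⟩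
  ∣ b + x - b + y ∣ ≡⟨ ∣m+n-m+o∣≡∣n-o∣ b x y ⟩
  ∣ x - y ∣         ∎
  where open ≡-Reasoning

window-step : ∀ (a : Series) m n →
  windowSum a m (suc n) + back a (suc n) m ≡ a (suc n) + windowSum a m n
window-step a zero    n = sym (+-identityʳ (a (suc n)))
window-step a (suc m) n = begin
  windowSum a m (suc n) + back a (suc n) m + back a n m ≡⟨ cong (_+ back a n m) (window-step a m n) ⟩
  a (suc n) + windowSum a m n + back a n m              ≡⟨ +-assoc (a (suc n)) _ _ ⟩
  a (suc n) + (windowSum a m n + back a n m)            ∎
  where open ≡-Reasoning

window-stepDiff : ∀ (a : Series) m n → stepDiff (windowSum a m) (suc n) ≡ diffAbs a m (suc n)
window-stepDiff a m n =
  trans (∣-∣-comm (windowSum a m n) (windowSum a m (suc n)))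
        (sym (∣-∣-balance (windowSum a m (suc n)) (back a (suc n) m) (a (suc n)) (windowSum a m n)
                          (window-step a m n)))

part-a : ∀ (a : Series) m → RTN₁ (seriesA a m) → LittleO (diffAbs a m) (windowSum a m)
part-a a m (_ , ratio) =
  o-≤ˡ (1 , λ { (suc n) _ → ≤-reflexive (sym (window-stepDiff a m n)) }) ratio

back-≤ : ∀ {a r : Series} → (∀ n → a n ≤ r n) → ∀ n j → back a n j ≤ r (n ∸ j)
back-≤ a≤r n       zero    = a≤r n
back-≤ a≤r zero    (suc j) = z≤n
back-≤ a≤r (suc n) (suc j) = back-≤ a≤r n j

-- If a ≤ R and R is doubling, every window sum of a is O(R), since a(n-j) ≤ 2^j·R(n).
window-≲ : ∀ {a R : Series} → (∀ n → a n ≤ R n) → Doubling R →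
  ∀ m → ∃[ C ] Eventually (λ n → windowSum a m n ≤ C * R n)
window-≲ a≤R dbl zero = 0 , 0 , λ _ _ → z≤n
window-≲ {a} {R} a≤R dbl (suc m) with window-≲ a≤R dbl m
... | C , bounded = C + 2 ^ m , eventually-map bound (eventually-both bounded (doubling-iterate dbl m))
  where
  open ≤-Reasoning
  bound : ∀ {n} → windowSum a m n ≤ C * R n × R (n ∸ m) ≤ 2 ^ m * R n →
          windowSum a (suc m) n ≤ (C + 2 ^ m) * R n
  bound {n} (window≤ , back≤) = begin
    windowSum a m n + back a n m ≤⟨ +-mono-≤ window≤ (≤-trans (back-≤ a≤R n m) back≤) ⟩
    C * R n + 2 ^ m * R n        ≡⟨ *-distribʳ-+ (R n) C (2 ^ m) ⟨
    (C + 2 ^ m) * R n            ∎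

a-≤-window : ∀ (a : Series) u n → a n ≤ windowSum a (suc u) n
a-≤-window a zero    n = ≤-refl
a-≤-window a (suc u) n = ≤-trans (a-≤-window a u n) (m≤m+n _ _)

-- The asymptotic periods of a at a doubling scale R: the lags m with a(n) - a(n-m) = o(R(n)).
-- They contain 0 and are closed under sums and differences, hence (Bézout) under gcd.
module Periods (a R : Series) (R-doubling : Doubling R) where

  Period : ℕ → Set
  Period m = LittleO (diffAbs a m) R

  period-zero : Period 0
  period-zero = o-≤ˡ (0 , λ n _ → ≤-reflexive (∣n-n∣≡0 (a n))) o-zero

  diff-back : ∀ m q n → m ≤ n → ∣ back a n m - back a n (m + q) ∣ ≡ diffAbs a q (n ∸ m)
  diff-back m q n m≤n = sym (cong₂ ∣_-_∣
    (trans (back-shift a m n 0 m≤n) (cong (back a n) (+-identityʳ m)))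
    (back-shift a m n q m≤n))

  period-+ : ∀ m q → Period m → Period q → Period (m + q)
  period-+ m q pm pq = o-≤ˡ (m , triangle) (o-+ pm (o-shift R-doubling m pq))
    where
    triangle : ∀ n → m ≤ n → diffAbs a (m + q) n ≤ diffAbs a m n + diffAbs a q (n ∸ m)
    triangle n m≤n = subst (λ d → diffAbs a (m + q) n ≤ diffAbs a m n + d) (diff-back m q n m≤n)
      (∣-∣-triangle (a n) (back a n m) (back a n (m + q)))

  period-∸ : ∀ m q → Period (m + q) → Period q → Period m
  period-∸ m q pmq pq = o-≤ˡ (m , triangle) (o-+ pmq (o-shift R-doubling m pq))
    where
    triangle : ∀ n → m ≤ n → diffAbs a m n ≤ diffAbs a (m + q) n + diffAbs a q (n ∸ m)
    triangle n m≤n = subst (λ d → diffAbs a m n ≤ diffAbs a (m + q) n + d)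
      (trans (∣-∣-comm (back a n (m + q)) (back a n m)) (diff-back m q n m≤n))
      (∣-∣-triangle (a n) (back a n (m + q)) (back a n m))

  period-* : ∀ x m → Period m → Period (x * m)
  period-* zero    _ _  = period-zero
  period-* (suc x) m pm = period-+ m (x * m) pm (period-* x m pm)

  period-gcd : ∀ m q → Period m → Period q → Period (gcd m q)
  period-gcd m q pm pq with Bézout.identity (gcd-GCD m q)
  ... | Bézout.+- x y eq = period-∸ (gcd m q) (y * q) (subst Period (sym eq) (period-* x m pm)) (period-* y q pq)
  ... | Bézout.-+ x y eq = period-∸ (gcd m q) (x * m) (subst Period (sym eq) (period-* y q pq)) (period-* x m pm)

  period-gcdList : ∀ ms → All Period ms → Period (gcdList ms)
  period-gcdList []       []         = period-zero
  period-gcdList (m ∷ ms) (pm ∷ pms) = period-gcd m (gcdList ms) pm (period-gcdList ms pms)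

  period-of-rtn : (∀ n → a n ≤ R n) → ∀ m → RTN₁ (seriesA a m) → Period m
  period-of-rtn a≤R m rt with window-≲ a≤R R-doubling m
  ... | C , window≲R = o-weakenʳ C (part-a a m rt) window≲R

-- The common core of (b) and (c).  The first window length u + 1 gives a scale W = A_{u+1}
-- with W ∈ RTN₁ and a ≤ W; at this scale every mᵢ, hence gcd(ms), is a period.
gcd-period : ∀ (a : Series) ms → ms ≢ [] → All (0 <_) ms → All (λ m → RTN₁ (seriesA a m)) ms →
  ∃[ u ] (RTN₁ (windowSum a (suc u)) × LittleO (diffAbs a (gcdList ms)) (windowSum a (suc u)))
gcd-period a []           nonempty _         _            = ⊥-elim (nonempty refl)
gcd-period a (zero ∷ ms)  _        (() ∷ _)  _
gcd-period a (suc u ∷ ms) _        _         rts@(rt ∷ _) =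
  u , rt , period-gcdList (suc u ∷ ms) (All-map (λ {m} → period-of-rtn (a-≤-window a u) m) rts)
  where open Periods a (windowSum a (suc u)) (rtn-doubling _ rt)

diffSum : Series → ℕ → ℕ → ℕ
diffSum a zero    n = 0
diffSum a (suc M) n = diffSum a M n + diffAbs a M n

-- Each a(n-j) is within |a(n) - a(n-j)| of a(n), so Σ_{j<M} a(n-j) ≤ M·a(n) + diffSum M n.
window-≤ : ∀ (a : Series) M n → windowSum a M n ≤ M * a n + diffSum a M n
window-≤ a zero    n = z≤n
window-≤ a (suc M) n = begin
  windowSum a M n + back a n M                      ≤⟨ +-mono-≤ (window-≤ a M n) (m≤n+∣n-m∣ (back a n M) (a n)) ⟩
  (M * a n + diffSum a M n) + (a n + diffAbs a M n) ≡⟨ solve 4 (λ p q r s → (p :+ q) :+ (r :+ s)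
                                                                  := (r :+ p) :+ (q :+ s))
                                                        refl (M * a n) (diffSum a M n) (a n) (diffAbs a M n) ⟩
  (a n + M * a n) + (diffSum a M n + diffAbs a M n) ∎
  where
  open ≤-Reasoning
  open +-*-Solver

positive-of-≤-multiple : ∀ C {x y} → 0 < y → y ≤ C * x → 0 < x
positive-of-≤-multiple C {zero} {y} 0<y y≤C*0 = ⊥-elim (<⇒≱ 0<y (subst (y ≤_) (*-zeroʳ C) y≤C*0))
positive-of-≤-multiple C {suc x} _ _ = s≤s z≤n

-- Every lag is then a period, so W(n) ≤ (u+1)·a(n) + o(W(n)), i.e. W = O(a); positivity
-- of W and the estimate a(n) - a(n-1) = o(W) = o(a) give both halves of RTN₁ a.
unit-period-rtn : ∀ (a : Series) u → RTN₁ (windowSum a (suc u)) →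
  LittleO (diffAbs a 1) (windowSum a (suc u)) → RTN₁ a
unit-period-rtn a u W-rtn@((N , W-positive) , _) unit = positive , ratio
  where
  M : ℕ
  M = suc u
  W : Series
  W = windowSum a M
  open Periods a W (rtn-doubling W W-rtn)

  -- every lag is a period, so the sums of lag differences are o(W)
  diffSum-small : ∀ L → LittleO (diffSum a L) W
  diffSum-small zero    = o-zero
  diffSum-small (suc L) = o-+ (diffSum-small L) (subst Period (*-identityʳ L) (period-* L 1 unit))

  -- W ≤ M·a + diffSum M ≤ M·a + W/2 eventually
  W-≲-a : Eventually (λ n → W n ≤ 2 * M * a n)
  W-≲-a = eventually-map bound (diffSum-small M 1)
    where
    open ≤-Reasoning
    bound : ∀ {n} → 2 * diffSum a M n ≤ W n → W n ≤ 2 * M * a n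
    bound {n} small = +-cancelʳ-≤ (W n) (W n) (2 * M * a n) (begin
      W n + W n                        ≡⟨ cong (W n +_) (+-identityʳ (W n)) ⟨
      2 * W n                          ≤⟨ *-monoʳ-≤ 2 (window-≤ a M n) ⟩
      2 * (M * a n + diffSum a M n)    ≡⟨ *-distribˡ-+ 2 (M * a n) (diffSum a M n) ⟩
      2 * (M * a n) + 2 * diffSum a M n ≤⟨ +-monoʳ-≤ (2 * (M * a n)) small ⟩
      2 * (M * a n) + W n              ≡⟨ cong (_+ W n) (*-assoc 2 M (a n)) ⟨
      2 * M * a n + W n                ∎)

  positive : Eventually (λ n → 0 < a n)
  positive = eventually-map (λ (0<W , W≤) → positive-of-≤-multiple (2 * M) 0<W W≤)
                            (eventually-both (N , W-positive) W-≲-a)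

  ratio : LittleO (stepDiff a) a
  ratio = o-≤ˡ (1 , λ { (suc n) _ → ≤-reflexive (∣-∣-comm (a n) (a (suc n))) })
               (o-weakenʳ (2 * M) unit W-≲-a)

part-b : ∀ (a : Series) ms → ms ≢ [] → All (0 <_) ms → All (λ m → RTN₁ (seriesA a m)) ms →
  ∃[ u ] LittleO (diffAbs a (gcdList ms)) (windowSum a (suc u))
part-b a ms nonempty positive rtns with gcd-period a ms nonempty positive rtns
... | u , _ , gcd-small = u , gcd-small

part-c : ∀ (a : Series) ms → ms ≢ [] → All (0 <_) ms → All (λ m → RTN₁ (seriesA a m)) ms →
  gcdList ms ≡ 1 → RTN₁ a
part-c a ms nonempty positive rtns gcd≡1 with gcd-period a ms nonempty positive rtns
... | u , W-rtn , gcd-small =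
  unit-period-rtn a u W-rtn (subst (λ d → LittleO (diffAbs a d) (windowSum a (suc u))) gcd≡1 gcd-small)

lemma4p11 :
    ((a : Series) (m : ℕ) → 0 < m → RTN₁ (seriesA a m) →
      LittleO (diffAbs a m) (windowSum a m))
    ×
    ((a : Series) (ms : List ℕ) → ms ≢ [] → All (0 <_) ms →
      All (λ mᵢ → RTN₁ (seriesA a mᵢ)) ms →
      ∃[ u ] LittleO (diffAbs a (gcdList ms)) (windowSum a (suc u)))
    ×
    ((a : Series) (ms : List ℕ) → ms ≢ [] → All (0 <_) ms →
      All (λ mᵢ → RTN₁ (seriesA a mᵢ)) ms →
      gcdList ms ≡ 1 → RTN₁ a)
lemma4p11 = (λ a m _ → part-a a m) , part-b , part-c
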